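{- For every integer $n\ge 4$ and every vertex $v$ of the complete graph $K_n$, $\Pi_v^v(K_n)\cong\mathbb{Z}/2$.
   Context: $K_n$ is the loopless graph on $n$ vertices with every two distinct vertices adjacent. A walk is a sequence $(v_0\cdots v_m)$ of vertices with $v_i\sim v_{i+1}$. A prune of a walk with $v_i=v_{i+2}$ replaces the segment $v_iv_{i+1}v_i$ by $v_i$; a spider move on $(v_0\cdots v_m)$ replaces one vertex $v_i$, $0<i<m$, by a vertex $v_i'$ with $v_{i-1}\sim v_i'\sim v_{i+1}$. Two walks are equivalent if connected by finitely many prunes, inverse prunes and spider moves. $\Pi_v^v(G)$ (the fundamental group) is the group of equivalence classes of closed walks starting and ending at $v$, with multiplication given by concatenation. -}

module Defs where

open import Data.Nat using (ℕ)
open import Data.Fin using (Fin)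
open import Data.List using (List; []; _∷_; _++_; head; last; drop)
open import Data.Maybe using (just)
open import Data.Product using (_×_)
open import Relation.Binary.PropositionalEquality using (_≡_; _≢_)
open import Data.List.Relation.Unary.Linked using (Linked)
open import Relation.Binary.Construct.Closure.Equivalence using (EqClosure)

_∼_ : {n : ℕ} → Fin n → Fin n → Set
x ∼ y = x ≢ y

IsWalk : {n : ℕ} → List (Fin n) → Set
IsWalk l = Linked _∼_ l

ClosedWalkAt : {n : ℕ} → Fin n → List (Fin n) → Set
ClosedWalkAt v l = IsWalk l × head l ≡ just v × last l ≡ just v

-- Side conditions ensure that both sides are walks whenever the
-- surrounding sequence is, so the symmetric closure (inverse prunes,
-- inverse spider moves) never leaves the set of walks.
data Move {n : ℕ} : List (Fin n) → List (Fin n) → Set where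
  prune  : ∀ xs ys a b → a ∼ b →
           Move (xs ++ a ∷ b ∷ a ∷ ys) (xs ++ a ∷ ys)
  spider : ∀ xs ys a b b' c → a ∼ b → b ∼ c → a ∼ b' → b' ∼ c →
           Move (xs ++ a ∷ b ∷ c ∷ ys) (xs ++ a ∷ b' ∷ c ∷ ys)

_≃w_ : {n : ℕ} → List (Fin n) → List (Fin n) → Set
_≃w_ = EqClosure Move

_·w_ : {n : ℕ} → List (Fin n) → List (Fin n) → List (Fin n)
l ·w l' = l ++ drop 1 l'

-- The invariant is the parity of the number of edges: a prune removes two
-- edges and a spider move keeps the length, so the parity is a well-defined
-- homomorphism to ℤ/2. Conversely, once four vertices are available any
-- four-edge stretch of a walk can be shortened to two edges with the same
-- ends, so every closed walk at v reduces to the trivial walk, a back-and-forth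
-- v b v (which prunes away) or a triangle v a b v, and any two triangles
-- through v are related by spider moves.
module Submission where

open import Defs
open import Data.Nat using (ℕ; _≤_; _<_)
open import Data.Fin using (Fin; _≟_)
open import Data.Fin.Properties using (¬∀⟶∃¬; pigeonhole; <⇒≢)
open import Data.Bool using (Bool; _xor_; true; false; not)
open import Data.Bool.Properties using (not-involutive; not-distribˡ-xor)
open import Data.List using (List; []; _∷_; _++_; length; lookup; last)
open import Data.List.Relation.Unary.Any using (here; there; index)
open import Data.List.Relation.Unary.Any.Properties using (lookup-index)
open import Data.List.Membership.Propositional using (_∈_; _∉_)
import Data.List.Membership.DecPropositional as DecMembership
open import Data.List.Relation.Unary.Linked using ([]; [-]; _∷_)
open import Data.Maybe using (just)
open import Data.Product using (Σ; ∃; _×_; _,_)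
open import Data.Sum using (_⊎_; inj₁; inj₂)
open import Data.Empty using (⊥-elim)
open import Function.Bundles using (_⇔_; mk⇔)
open import Relation.Nullary using (¬_; yes; no)
open import Relation.Binary.PropositionalEquality
  using (_≡_; refl; sym; trans; cong; subst; ≢-sym; isEquivalence; module ≡-Reasoning)
import Relation.Binary.Construct.On as On
open import Relation.Binary.Construct.Closure.Equivalence as EqClosure using ()
open import Relation.Binary.Construct.Closure.ReflexiveTransitive using (ε; _◅_; _◅◅_)
open import Relation.Binary.Construct.Closure.Symmetric using (fwd)

∼-sym : ∀ {n} {a b : Fin n} → a ∼ b → b ∼ a
∼-sym = ≢-sym

fresh : ∀ {n} (xs : List (Fin n)) → length xs < n → ∃ λ z → z ∉ xs
fresh {n} xs |xs|<n = ¬∀⟶∃¬ n (_∈ xs) (λ z → DecMembership._∈?_ _≟_ z xs) no-cover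
  where
  no-cover : ¬ (∀ z → z ∈ xs)
  no-cover cover with pigeonhole |xs|<n (λ z → index (cover z))
  ... | i , j , i<j , same-index = <⇒≢ i<j (begin
    i                           ≡⟨ lookup-index (cover i) ⟩
    lookup xs (index (cover i)) ≡⟨ cong (lookup xs) same-index ⟩
    lookup xs (index (cover j)) ≡⟨ sym (lookup-index (cover j)) ⟩
    j                           ∎)
    where open ≡-Reasoning

oddLength : ∀ {a} {A : Set a} → List A → Bool
oddLength []       = false
oddLength (_ ∷ xs) = not (oddLength xs)

edgeParity : ∀ {a} {A : Set a} → List A → Bool
edgeParity []       = false
edgeParity (_ ∷ xs) = oddLength xs

oddLength-++ : ∀ {a} {A : Set a} (xs ys : List A) →
  oddLength (xs ++ ys) ≡ oddLength xs xor oddLength ys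
oddLength-++ []       ys = refl
oddLength-++ (_ ∷ xs) ys =
  trans (cong not (oddLength-++ xs ys)) (not-distribˡ-xor (oddLength xs) (oddLength ys))

oddLength-++-congʳ : ∀ {a} {A : Set a} (xs : List A) {ys ys′ : List A} →
  oddLength ys ≡ oddLength ys′ → oddLength (xs ++ ys) ≡ oddLength (xs ++ ys′)
oddLength-++-congʳ xs {ys} {ys′} eq = begin
  oddLength (xs ++ ys)            ≡⟨ oddLength-++ xs ys ⟩
  oddLength xs xor oddLength ys   ≡⟨ cong (oddLength xs xor_) eq ⟩
  oddLength xs xor oddLength ys′  ≡⟨ oddLength-++ xs ys′ ⟨
  oddLength (xs ++ ys′)           ∎
  where open ≡-Reasoning

edgeParity-move : ∀ {n} {l l′ : List (Fin n)} → Move l l′ → edgeParity l ≡ edgeParity l′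
edgeParity-move (prune []       ys _ _ _)           = not-involutive (oddLength ys)
edgeParity-move (prune (_ ∷ xs) _  _ _ _)           = oddLength-++-congʳ xs (not-involutive _)
edgeParity-move (spider []       _ _ _ _ _ _ _ _ _) = refl
edgeParity-move (spider (_ ∷ xs) _ _ _ _ _ _ _ _ _) = oddLength-++-congʳ xs refl

edgeParity-resp-≃w : ∀ {n} {l l′ : List (Fin n)} → l ≃w l′ → edgeParity l ≡ edgeParity l′
edgeParity-resp-≃w = EqClosure.fold (On.isEquivalence edgeParity isEquivalence) edgeParity-move

edgeParity-·w : ∀ {n} {v : Fin n} {l l′} → ClosedWalkAt v l → ClosedWalkAt v l′ →
  edgeParity (l ·w l′) ≡ edgeParity l xor edgeParity l′
edgeParity-·w {l = []}     (_ , () , _) _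
edgeParity-·w {l′ = []}    _            (_ , () , _)
edgeParity-·w {l = _ ∷ xs} {_ ∷ ys} _ _ = oddLength-++ xs ys

Move-cons : ∀ {n} (a : Fin n) {l l′} → Move l l′ → Move (a ∷ l) (a ∷ l′)
Move-cons a (prune xs ys b c bc)                  = prune (a ∷ xs) ys b c bc
Move-cons a (spider xs ys b c c′ d bc cd bc′ c′d) = spider (a ∷ xs) ys b c c′ d bc cd bc′ c′d

≃w-cons : ∀ {n} (a : Fin n) {l l′} → l ≃w l′ → (a ∷ l) ≃w (a ∷ l′)
≃w-cons a = EqClosure.gmap (a ∷_) (Move-cons a)

step : ∀ {n} {l l′ : List (Fin n)} → Move l l′ → l ≃w l′
step m = fwd m ◅ ε

≃w-sym : ∀ {n} {l l′ : List (Fin n)} → l ≃w l′ → l′ ≃w l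
≃w-sym = EqClosure.symmetric Move

-- The spider move c ↦ a creates the spike a b a, which is then pruned.
backtrack : ∀ {n} {a b c d e : Fin n} → a ∼ b → b ∼ c → c ∼ d → a ∼ d →
  (a ∷ b ∷ c ∷ d ∷ e ∷ []) ≃w (a ∷ d ∷ e ∷ [])
backtrack {a = a} {b} {c} {d} {e} a∼b b∼c c∼d a∼d =
  step (spider (a ∷ []) (e ∷ []) b c a d b∼c c∼d (∼-sym a∼b) a∼d)
  ◅◅ step (prune [] (d ∷ e ∷ []) a b a∼b)

data Short {n : ℕ} : List (Fin n) → Set where
  edges₀ : Short []
  edges₁ : ∀ b → Short (b ∷ [])
  edges₂ : ∀ b c → Short (b ∷ c ∷ [])
  edges₃ : ∀ b c d → Short (b ∷ c ∷ d ∷ [])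

Reduced : ∀ {n} → Fin n → List (Fin n) → Set
Reduced {n} a t = Σ (List (Fin n)) λ s →
  Short s × IsWalk (a ∷ s) × last (a ∷ s) ≡ last (a ∷ t) × (a ∷ t) ≃w (a ∷ s)

record Triangle {n : ℕ} (v : Fin n) : Set where
  constructor triangle
  field
    {a b} : Fin n
    v∼a : v ∼ a
    a∼b : a ∼ b
    b∼v : b ∼ v

  walk : List (Fin n)
  walk = v ∷ a ∷ b ∷ v ∷ []

  isClosedWalk : ClosedWalkAt v walk
  isClosedWalk = (v∼a ∷ a∼b ∷ b∼v ∷ [-]) , refl , refl

open Triangle using (walk)

TrivialOrTriangle : ∀ {n} → Fin n → List (Fin n) → Set
TrivialOrTriangle v l = l ≃w (v ∷ []) ⊎ Σ (Triangle v) λ t → l ≃w walk t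

short-closed : ∀ {n} {v : Fin n} {s} → Short s → IsWalk (v ∷ s) → last (v ∷ s) ≡ just v →
  TrivialOrTriangle v (v ∷ s)
short-closed edges₀         _                        _    = inj₁ ε
short-closed (edges₁ b)     (v∼b ∷ [-])              refl = ⊥-elim (v∼b refl)
short-closed (edges₂ b _)   (v∼b ∷ _ ∷ [-])          refl = inj₁ (step (prune [] [] _ b v∼b))
short-closed (edges₃ _ _ _) (v∼b ∷ b∼c ∷ c∼v ∷ [-]) refl = inj₂ (triangle v∼b b∼c c∼v , ε)

triangle-≃w-≢ : ∀ {n} {v : Fin n} (t t′ : Triangle v) → Triangle.a t′ ∼ Triangle.b t →
  walk t ≃w walk t′
triangle-≃w-≢ {v = v} (triangle {a} {b} v∼a a∼b b∼v) (triangle {p} {q} v∼p p∼q q∼v) p∼b =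
  step (spider [] (v ∷ []) v a p b v∼a a∼b v∼p p∼b)
  ◅◅ step (spider (v ∷ []) [] p b q v p∼b b∼v p∼q q∼v)

module _ {n : ℕ} (4≤n : 4 ≤ n) where

  commonNeighbour : (a b c : Fin n) → ∃ λ z → z ∼ a × z ∼ b × z ∼ c
  commonNeighbour a b c with fresh (a ∷ b ∷ c ∷ []) 4≤n
  ... | z , z∉ = z , (λ z≡a → z∉ (here z≡a)) , (λ z≡b → z∉ (there (here z≡b)))
                   , (λ z≡c → z∉ (there (there (here z≡c))))

  shortcut : {a b c d e : Fin n} → a ∼ b → b ∼ c → c ∼ d → d ∼ e →
    ∃ λ x → a ∼ x × x ∼ e × (a ∷ b ∷ c ∷ d ∷ e ∷ []) ≃w (a ∷ x ∷ e ∷ [])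
  shortcut {a} {b} {c} {d} {e} a∼b b∼c c∼d d∼e with a ≟ d
  ... | no a∼d = d , a∼d , d∼e , backtrack a∼b b∼c c∼d a∼d
  ... | yes refl with commonNeighbour a c e
  ... | d′ , d′∼a , d′∼c , d′∼e =
    d′ , ∼-sym d′∼a , d′∼e ,
    (step (spider (a ∷ b ∷ []) [] c a d′ e c∼d d∼e (∼-sym d′∼c) d′∼e)
     ◅◅ backtrack a∼b b∼c (∼-sym d′∼c) (∼-sym d′∼a))

  reduce : (a : Fin n) (t : List (Fin n)) → IsWalk (a ∷ t) → Reduced a t
  reduce a []      _         = [] , edges₀ , [-] , refl , ε
  reduce a (b ∷ t) (a∼b ∷ w) with reduce b t w
  ... | _ , edges₀       , _  , ends , eq = _ , edges₁ b , a∼b ∷ [-] , ends , ≃w-cons a eq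
  ... | _ , edges₁ c     , w′ , ends , eq = _ , edges₂ b c , a∼b ∷ w′ , ends , ≃w-cons a eq
  ... | _ , edges₂ c d   , w′ , ends , eq = _ , edges₃ b c d , a∼b ∷ w′ , ends , ≃w-cons a eq
  ... | _ , edges₃ c d e , b∼c ∷ c∼d ∷ d∼e ∷ [-] , ends , eq with shortcut a∼b b∼c c∼d d∼e
  ...   | x , a∼x , x∼e , shortened =
    _ , edges₂ x e , a∼x ∷ x∼e ∷ [-] , ends , (≃w-cons a eq ◅◅ shortened)

  triangle-≃w : ∀ {v} (t t′ : Triangle v) → walk t ≃w walk t′
  triangle-≃w t t′ with Triangle.a t′ ≟ Triangle.b t
  ... | no p∼b = triangle-≃w-≢ t t′ p∼b
  triangle-≃w {v} (triangle {a} {b} v∼a a∼b b∼v) t′ | yes refl with commonNeighbour v a b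
  ... | b′ , b′∼v , b′∼a , b′∼b =
    step (spider (v ∷ []) [] a b b′ v a∼b b∼v (∼-sym b′∼a) b′∼v)
    ◅◅ triangle-≃w-≢ (triangle v∼a (∼-sym b′∼a) b′∼v) t′ (∼-sym b′∼b)

  closedWalk-normal : ∀ {v l} → ClosedWalkAt v l → TrivialOrTriangle v l
  closedWalk-normal {v} {_ ∷ t} (w , refl , ends) with reduce v t w
  ... | s , short , w′ , ends′ , eq with short-closed short w′ (trans ends′ ends)
  ...   | inj₁ trivial      = inj₁ (eq ◅◅ trivial)
  ...   | inj₂ (t′ , tri)   = inj₂ (t′ , eq ◅◅ tri)

  triangleAt : (v : Fin n) → Triangle v
  triangleAt v with commonNeighbour v v v
  ... | a , a∼v , _ , _ with commonNeighbour v a a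
  ... | b , b∼v , b∼a , _ = triangle (∼-sym a∼v) (∼-sym b∼a) b∼v

  canonical : Fin n → Bool → List (Fin n)
  canonical v false = v ∷ []
  canonical v true  = walk (triangleAt v)

  canonical-closed : ∀ v p → ClosedWalkAt v (canonical v p)
  canonical-closed v false = [-] , refl , refl
  canonical-closed v true  = Triangle.isClosedWalk (triangleAt v)

  edgeParity-canonical : ∀ v p → edgeParity (canonical v p) ≡ p
  edgeParity-canonical v false = refl
  edgeParity-canonical v true  = refl

  ≃w-canonical : ∀ {v l} → ClosedWalkAt v l → l ≃w canonical v (edgeParity l)
  ≃w-canonical w with closedWalk-normal w
  ... | inj₁ trivial rewrite edgeParity-resp-≃w trivial = trivial
  ... | inj₂ (t , tri) rewrite edgeParity-resp-≃w tri = tri ◅◅ triangle-≃w t (triangleAt _)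

  edgeParity-complete : ∀ {v l l′} → ClosedWalkAt v l → ClosedWalkAt v l′ →
    edgeParity l ≡ edgeParity l′ → l ≃w l′
  edgeParity-complete {v} {l} w w′ same =
    subst (λ p → l ≃w canonical v p) same (≃w-canonical w) ◅◅ ≃w-sym (≃w-canonical w′)

proposition4p6 : (n : ℕ) → 4 ≤ n → (v : Fin n) →
    Σ (List (Fin n) → Bool) λ f →
      (∀ l l' → ClosedWalkAt v l → ClosedWalkAt v l' → f (l ·w l') ≡ (f l xor f l'))
      × (∀ l l' → ClosedWalkAt v l → ClosedWalkAt v l' → (l ≃w l') ⇔ (f l ≡ f l'))
      × (∀ b → ∃ λ l → ClosedWalkAt v l × f l ≡ b)
proposition4p6 n 4≤n v =
    edgeParity
  , (λ _ _ → edgeParity-·w)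
  , (λ _ _ w w′ → mk⇔ edgeParity-resp-≃w (edgeParity-complete 4≤n w w′))
  , (λ p → canonical 4≤n v p , canonical-closed 4≤n v p , edgeParity-canonical 4≤n v p)
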